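{- Let $n\ge1$, $p$ a prime, and $S\subset E_n$ with $|S|\ge2$, with parabolic type $R=\emptyset$. The following are equivalent: (i) $\mathcal{C}_S=\mathcal{C}_{\mathsf{pHa},S}$; (ii) $\mathcal{C}_{\mathsf{pHa},S}$ is homogeneous, i.e. there is $T\subset E_n$ with $\mathcal{C}_{\mathsf{pHa},S}=\{x\in\mathbb{Z}^n:F^{(s)}_T(x)\le0\ \forall s\in S\}$; (iii) every connected component of the chain diagram $\Gamma_n(\emptyset,S)$ has an odd number of elements.
   Context: $E_n=\{1,\dots,n\}$, indices mod $n$; $e_i$ standard basis of $\mathbb{Z}^n$; $\delta_T^{(m)}=-1$ if $m\in T$, $1$ otherwise; $F^{(d)}_T(x)=\sum_{j=0}^{n-1}p^j\delta_T^{(d+j)}x_{d+j}$. $\Gamma_n(\emptyset,S)$ is the graph on $E_n$ with an edge between $i$ and $i+1$ exactly when $i+1\notin S$. Let $\Phi(S)$ be the unique $T\subset E_n$ with $s-1\notin T$ for all $s\in S$ and such that for every $i$ with $i+1\notin S$ exactly one of $i,i+1$ lies in $T$; $\mathcal{C}_S=\{x:F^{(s)}_{\Phi(S)}(x)\le0\ \forall s\in S\}$. Put $\mathsf{ha}^{(i)}_{S}=-\delta_S^{(i)}e_i-p\,e_{i-1}$ and $\mathcal{C}_{\mathsf{pHa},S}=\{x\in\mathbb{Z}^n: mx\in\sum_{i\in S}\mathbb{N}\,\mathsf{ha}^{(i)}_S+\sum_{i\notin S}\mathbb{Z}\,\mathsf{ha}^{(i)}_S\text{ for some } m\ge1\}$.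 -}

module Defs where

open import Data.Nat as ℕ using (ℕ; zero; suc; NonZero; _∸_)
open import Data.Nat.DivMod using (_mod_)
open import Data.Integer as ℤ using (ℤ; +_; -_; _+_; _*_; _≤_)
open import Data.Fin using (Fin; toℕ) renaming (zero to fzero; suc to fsuc)
open import Data.Fin.Subset using (Subset; _∈_; _∉_; ∣_∣)
open import Data.Vec using (lookup)
open import Data.Bool using (if_then_else_)
open import Data.Product using (Σ; ∃; _×_)
open import Data.Sum using (_⊎_)
open import Relation.Nullary using (¬_)
open import Relation.Binary.PropositionalEquality using (_≡_)
open import Relation.Binary.Construct.Closure.ReflexiveTransitive using (Star)
open import Function.Bundles using (_⇔_)

-- E_n is modelled by Fin n = {0,…,n-1} (i ↦ i-1 relabelling; all notions are cyclic).
-- Vectors of ℤ^n are functions Fin n → ℤ.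

module _ (n : ℕ) {{_ : NonZero n}} where

  shift : Fin n → ℕ → Fin n
  shift i j = (toℕ i ℕ.+ j) mod n

  next : Fin n → Fin n
  next i = shift i 1

  prev : Fin n → Fin n
  prev i = shift i (n ∸ 1)

sumℕ : ℕ → (ℕ → ℤ) → ℤ
sumℕ zero    f = + 0
sumℕ (suc k) f = sumℕ k f + f k

sumFin : ∀ {n} → (Fin n → ℤ) → ℤ
sumFin {zero}  f = + 0
sumFin {suc n} f = f fzero + sumFin (λ i → f (fsuc i))

δeq : ∀ {n} → Fin n → Fin n → ℤ
δeq i k = if (toℕ i ℕ.≡ᵇ toℕ k) then + 1 else + 0

δ : ∀ {n} → Subset n → Fin n → ℤ
δ T m = if lookup T m then - (+ 1) else + 1

module _ (n : ℕ) {{_ : NonZero n}} (p : ℕ) where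

  F : Subset n → Fin n → (Fin n → ℤ) → ℤ
  F T d x = sumℕ n (λ j → (+ (p ℕ.^ j)) * (δ T (shift n d j) * x (shift n d j)))

  HomCone : Subset n → Subset n → (Fin n → ℤ) → Set
  HomCone S T x = ∀ s → s ∈ S → F T s x ≤ + 0

  IsΦ : Subset n → Subset n → Set
  IsΦ S T = (∀ s → s ∈ S → prev n s ∉ T)
          × (∀ i → next n i ∉ S →
               (i ∈ T × next n i ∉ T) ⊎ (i ∉ T × next n i ∈ T))

  ha : Subset n → Fin n → Fin n → ℤ
  ha S i k = - (δ S i * δeq i k) + - ((+ p) * δeq (prev n i) k)

  pHaCone : Subset n → (Fin n → ℤ) → Set
  pHaCone S x =
    Σ ℕ λ m → (1 ℕ.≤ m) ×
      Σ (Fin n → ℤ) λ c → (∀ i → i ∈ S → + 0 ≤ c i) ×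
        (∀ k → (+ m) * x k ≡ sumFin (λ i → c i * ha S i k))

  -- Chain diagram Γ_n(∅,S): edge between i and i+1 exactly when i+1 ∉ S (taken symmetric)
  Edge : Subset n → Fin n → Fin n → Set
  Edge S i j = (j ≡ next n i × next n i ∉ S) ⊎ (i ≡ next n j × next n j ∉ S)

  Connected : Subset n → Fin n → Fin n → Set
  Connected S = Star (Edge S)

  AllComponentsOdd : Subset n → Set
  AllComponentsOdd S =
    ∀ i → Σ (Subset n) λ C → (∀ j → (j ∈ C ⇔ Connected S i j)) × (∣ C ∣ ℕ.% 2 ≡ 1)

-- Write haSum c for the coordinates of Σᵢ cᵢ haᵢ, so (haSum c)ₖ = -δ_S(k) cₖ - p cₖ₊₁.  Everything rests on
-- one fact: as pⁿ > 1, a vector with |uₖ| = p |uₖ₊₁| all around the cycle vanishes.  It makes c ↦ haSum c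
-- injective, so a point of C_{pHa,S} has unique coefficients and they are ≥ 0 on S; and it gives
-- F_T^{(d)}(x) = (1 - pⁿ) w_d whenever δ_T(k) xₖ = wₖ - p wₖ₊₁.  If T obeys the sign rule
-- δ_T(k) δ_S(k) = -δ_T(k-1) and avoids S - 1, then F_T^{(d)}(haSum c) = (1 - pⁿ) c_d for d ∈ S, so both cones
-- are "c ≥ 0 on S".  Conversely, if some T cuts out C_{pHa,S}, testing F_T on ±haᵢ, on -haₛ and on
-- N haₛ - haₜ (N large) forces T to alternate along the edges of Γ and to avoid S and S - 1, hence the sign
-- rule.  Such a T alternates along each arc s, s+1, …, s+L-1 of Γ and ends outside T, so s ∉ T iff L is odd:
-- summing 1_C = 1_C 1_T + (1_C 1_T)∘prev + [s = ·](1 - 1_T(s)) over E_n gives |C| = 2A + 1 - 1_T(s).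
-- Φ(S) exists (the parity of the distance to the next point of S), which closes (i) ⇒ (ii) ⇒ (iii) ⇒ (i).

{-# OPTIONS --safe #-}
module Submission where

open import Defs
open import Data.Bool using (Bool; true; false; not; T; if_then_else_)
open import Data.Bool.Properties using (not-¬)
open import Data.Empty using (⊥-elim)
open import Data.Fin using (Fin; toℕ; fromℕ<) renaming (zero to fzero; suc to fsuc)
import Data.Fin.Properties as Fin
open import Data.Fin.Permutation using (Permutation′; permutation; _⟨$⟩ʳ_)
open import Data.Fin.Subset using (Subset; _∈_; _∉_; ∣_∣; _⊆_; ⁅_⁆)
open import Data.Fin.Subset.Properties using (_∈?_; p⊆q⇒∣p∣≤∣q∣; ∣⁅x⁆∣≡1; x∈⁅x⁆)
open import Data.Integer as ℤ using (ℤ; +_; -_; _+_; _*_; _-_; +≤+; +<+; -≤+; -<+)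
import Data.Integer.Properties as ℤ
open import Data.Integer.Tactic.RingSolver using (solve-∀)
open import Data.Nat as ℕ using (ℕ; zero; suc; NonZero; _∸_; _%_; z≤n; s≤s)
import Data.Nat.Properties as ℕ
open import Data.Nat.DivMod using (m%n<n; m<n⇒m%n≡m; [m+n]%n≡m%n; [m+kn]%n≡m%n; %-distribˡ-+; m%n%n≡m%n)
open import Data.Nat.Primality using (Prime; prime⇒nonTrivial)
open import Data.Product using (Σ; _×_; _,_; proj₁; proj₂)
open import Data.Sum as Sum using (_⊎_; inj₁; inj₂)
open import Data.Vec using (lookup; tabulate; _∷_; [])
import Data.Vec.Properties as Vec
open import Function.Base using (_∘_)
open import Function.Bundles using (_⇔_; mk⇔; Equivalence)
open import Function.Properties.Equivalence using () renaming (sym to ⇔-sym)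
open import Algebra.Properties.CommutativeMonoid.Sum ℤ.+-0-commutativeMonoid
  using (sum; sum-cong-≗; ∑-distrib-+; sum-permute; sum-replicate-zero)
open import Relation.Binary.Construct.Closure.ReflexiveTransitive using (ε; _◅_; _◅◅_; reverse)
open import Relation.Binary.PropositionalEquality
open import Relation.Nullary using (¬_; Dec; yes; no; does; ¬?; _×-dec_)
open import Relation.Nullary.Decidable using (dec-true)

module _ where
  open import Data.Integer using (_≤_; _<_)

  sumℕ-cong : ∀ m {f g : ℕ → ℤ} → (∀ j → f j ≡ g j) → sumℕ m f ≡ sumℕ m g
  sumℕ-cong zero    f≗g = refl
  sumℕ-cong (suc m) f≗g = cong₂ _+_ (sumℕ-cong m f≗g) (f≗g m)

  *-distribˡ-sumℕ : ∀ m a (f : ℕ → ℤ) → a * sumℕ m f ≡ sumℕ m (λ j → a * f j)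
  *-distribˡ-sumℕ zero    a f = ℤ.*-zeroʳ a
  *-distribˡ-sumℕ (suc m) a f =
    trans (ℤ.*-distribˡ-+ a (sumℕ m f) (f m)) (cong (_+ a * f m) (*-distribˡ-sumℕ m a f))

  sumℕ-distrib-+ : ∀ m (f g : ℕ → ℤ) → sumℕ m (λ j → f j + g j) ≡ sumℕ m f + sumℕ m g
  sumℕ-distrib-+ zero    f g = refl
  sumℕ-distrib-+ (suc m) f g =
    trans (cong (_+ (f m + g m)) (sumℕ-distrib-+ m f g)) (swap (sumℕ m f) (sumℕ m g) (f m) (g m))
    where
    swap : ∀ a b c d → a + b + (c + d) ≡ a + c + (b + d)
    swap = solve-∀

  sumℕ-mono-≤ : ∀ m {f g : ℕ → ℤ} → (∀ j → f j ≤ g j) → sumℕ m f ≤ sumℕ m g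
  sumℕ-mono-≤ zero    f≤g = ℤ.≤-refl
  sumℕ-mono-≤ (suc m) f≤g = ℤ.+-mono-≤ (sumℕ-mono-≤ m f≤g) (f≤g m)

  sumℕ-nonneg : ∀ m {f : ℕ → ℤ} → (∀ j → + 0 ≤ f j) → + 0 ≤ sumℕ m f
  sumℕ-nonneg zero    0≤f = ℤ.≤-refl
  sumℕ-nonneg (suc m) 0≤f = ℤ.+-mono-≤ (sumℕ-nonneg m 0≤f) (0≤f m)

  term≤sumℕ : ∀ m {f : ℕ → ℤ} → (∀ j → + 0 ≤ f j) → ∀ j → j ℕ.< m → f j ≤ sumℕ m f
  term≤sumℕ (suc m) {f} 0≤f j j<1+m with j ℕ.≟ m
  ... | yes refl = ℤ.≤-trans (ℤ.≤-reflexive (sym (ℤ.+-identityˡ (f j))))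
                             (ℤ.+-monoˡ-≤ (f j) (sumℕ-nonneg m 0≤f))
  ... | no j≢m   = ℤ.≤-trans (ℤ.≤-reflexive (sym (ℤ.+-identityʳ (f j))))
                             (ℤ.+-mono-≤ (term≤sumℕ m 0≤f j (ℕ.≤∧≢⇒< (ℕ.≤-pred j<1+m) j≢m)) (0≤f m))

  sumℕ-geometric-shift : ∀ p N (h : ℕ → ℤ) →
    sumℕ N (λ j → + (p ℕ.^ j) * h j) + + (p ℕ.^ N) * h N ≡ h 0 + + p * sumℕ N (λ j → + (p ℕ.^ j) * h (suc j))
  sumℕ-geometric-shift p zero    h = base (h 0) (+ p)
    where
    base : ∀ h₀ q → + 0 + + 1 * h₀ ≡ h₀ + q * + 0
    base = solve-∀
  sumℕ-geometric-shift p (suc N) h = begin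
    sumℕ N f + f N + + (p ℕ.^ suc N) * h (suc N)
      ≡⟨ cong (_+ + (p ℕ.^ suc N) * h (suc N)) (sumℕ-geometric-shift p N h) ⟩
    h 0 + + p * Σ′ + + (p ℕ.^ suc N) * h (suc N)
      ≡⟨ cong (λ z → h 0 + + p * Σ′ + z * h (suc N)) (ℤ.pos-* p (p ℕ.^ N)) ⟩
    h 0 + + p * Σ′ + + p * + (p ℕ.^ N) * h (suc N)
      ≡⟨ regroup (h 0) (+ p) Σ′ (+ (p ℕ.^ N)) (h (suc N)) ⟩
    h 0 + + p * (Σ′ + + (p ℕ.^ N) * h (suc N)) ∎
    where
    open ≡-Reasoning
    f : ℕ → ℤ
    f j = + (p ℕ.^ j) * h j
    Σ′ = sumℕ N (λ j → + (p ℕ.^ j) * h (suc j))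
    regroup : ∀ h₀ q s r hN → h₀ + q * s + q * r * hN ≡ h₀ + q * (s + r * hN)
    regroup = solve-∀

  sumFin≡sum : ∀ {m} (f : Fin m → ℤ) → sumFin f ≡ sum f
  sumFin≡sum {zero}  f = refl
  sumFin≡sum {suc m} f = cong (λ z → f fzero + z) (sumFin≡sum (λ i → f (fsuc i)))

  sumFin-cong : ∀ {m} {f g : Fin m → ℤ} → (∀ i → f i ≡ g i) → sumFin f ≡ sumFin g
  sumFin-cong {f = f} {g} f≗g = trans (sumFin≡sum f) (trans (sum-cong-≗ f≗g) (sym (sumFin≡sum g)))

  sumFin-distrib-+ : ∀ {m} (f g : Fin m → ℤ) → sumFin (λ i → f i + g i) ≡ sumFin f + sumFin g
  sumFin-distrib-+ f g = trans (sumFin≡sum (λ i → f i + g i))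
    (trans (∑-distrib-+ f g) (sym (cong₂ _+_ (sumFin≡sum f) (sumFin≡sum g))))

  sumFin-permute : ∀ {m} (f : Fin m → ℤ) (π : Permutation′ m) → sumFin f ≡ sumFin (λ i → f (π ⟨$⟩ʳ i))
  sumFin-permute f π = trans (sumFin≡sum f) (trans (sum-permute f π) (sym (sumFin≡sum (λ i → f (π ⟨$⟩ʳ i)))))

  sumFin-nonneg : ∀ {m} {f : Fin m → ℤ} → (∀ i → + 0 ≤ f i) → + 0 ≤ sumFin f
  sumFin-nonneg {zero}  0≤f = ℤ.≤-refl
  sumFin-nonneg {suc m} 0≤f = ℤ.+-mono-≤ (0≤f fzero) (sumFin-nonneg (λ i → 0≤f (fsuc i)))

  δeq-refl : ∀ {m} (i : Fin m) → δeq i i ≡ + 1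
  δeq-refl i with toℕ i ℕ.≡ᵇ toℕ i | ℕ.≡⇒≡ᵇ (toℕ i) (toℕ i) refl
  ... | true | _ = refl

  δeq-≢ : ∀ {m} {i k : Fin m} → ¬ i ≡ k → δeq i k ≡ + 0
  δeq-≢ {i = i} {k} i≢k with toℕ i ℕ.≡ᵇ toℕ k in eq
  ... | false = refl
  ... | true  = ⊥-elim (i≢k (Fin.toℕ-injective (ℕ.≡ᵇ⇒≡ (toℕ i) (toℕ k) (subst T (sym eq) _))))

  δeq-sym : ∀ {m} (i k : Fin m) → δeq i k ≡ δeq k i
  δeq-sym i k with i Fin.≟ k
  ... | yes refl = refl
  ... | no i≢k   = trans (δeq-≢ i≢k) (sym (δeq-≢ (λ k≡i → i≢k (sym k≡i))))

  δeq-swap : ∀ {m} (f : Fin m → ℤ) (i k : Fin m) → f i * δeq i k ≡ f k * δeq i k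
  δeq-swap f i k with i Fin.≟ k
  ... | yes refl = refl
  ... | no i≢k   = trans (cong (f i *_) (δeq-≢ i≢k))
                    (trans (ℤ.*-zeroʳ (f i)) (sym (trans (cong (f k *_) (δeq-≢ i≢k)) (ℤ.*-zeroʳ (f k)))))

  *δeq-cong : ∀ {m} (g h : Fin m → ℤ) {s} → g s ≡ h s → ∀ k → g k * δeq s k ≡ h k * δeq s k
  *δeq-cong g h {s} g≡h k = trans (sym (δeq-swap g s k)) (trans (cong (_* δeq s k) g≡h) (δeq-swap h s k))

  δeq-0∨1 : ∀ {m} (i k : Fin m) → δeq i k ≡ + 0 ⊎ δeq i k ≡ + 1
  δeq-0∨1 i k with i Fin.≟ k
  ... | yes refl = inj₂ (δeq-refl i)
  ... | no i≢k   = inj₁ (δeq-≢ i≢k)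

  0≤δeq : ∀ {m} (i k : Fin m) → + 0 ≤ δeq i k
  0≤δeq i k with δeq-0∨1 i k
  ... | inj₁ e = ℤ.≤-reflexive (sym e)
  ... | inj₂ e = subst (+ 0 ≤_) (sym e) (+≤+ z≤n)

  δeq-*-lower : ∀ {m} (i k : Fin m) {L v} → L ≤ + 0 → L ≤ v → L ≤ δeq i k * v
  δeq-*-lower i k {L} {v} L≤0 L≤v with δeq-0∨1 i k
  ... | inj₁ e = subst (L ≤_) (sym (trans (cong (_* v) e) (ℤ.*-zeroˡ v))) L≤0
  ... | inj₂ e = subst (L ≤_) (sym (trans (cong (_* v) e) (ℤ.*-identityˡ v))) L≤v

  sumFin-δeq : ∀ {m} (g : Fin m → ℤ) (k : Fin m) → sumFin (λ i → g i * δeq i k) ≡ g k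
  sumFin-δeq {suc m} g fzero = begin
    g fzero * + 1 + sumFin (λ i → g (fsuc i) * + 0)
      ≡⟨ cong₂ _+_ (ℤ.*-identityʳ (g fzero)) (sumFin-cong (λ i → ℤ.*-zeroʳ (g (fsuc i)))) ⟩
    g fzero + sumFin {m} (λ _ → + 0)
      ≡⟨ cong (λ z → g fzero + z) (trans (sumFin≡sum {m} (λ _ → + 0)) (sum-replicate-zero m)) ⟩
    g fzero + + 0
      ≡⟨ ℤ.+-identityʳ (g fzero) ⟩
    g fzero ∎
    where open ≡-Reasoning
  sumFin-δeq {suc m} g (fsuc k) =
    trans (cong (_+ sumFin (λ i → g (fsuc i) * δeq (fsuc i) (fsuc k))) (ℤ.*-zeroʳ (g fzero)))
          (trans (ℤ.+-identityˡ _) (sumFin-δeq (λ i → g (fsuc i)) k))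

  indicator : Bool → ℤ
  indicator true  = + 1
  indicator false = + 0

  indicator-∈ : ∀ {m} {C : Subset m} {i} → i ∈ C → indicator (lookup C i) ≡ + 1
  indicator-∈ i∈C rewrite Vec.[]=⇒lookup i∈C = refl

  indicator-∉ : ∀ {m} {C : Subset m} {i} → i ∉ C → indicator (lookup C i) ≡ + 0
  indicator-∉ {C = C} {i} i∉C with lookup C i in eq
  ... | true  = ⊥-elim (i∉C (Vec.lookup⇒[]= i C eq))
  ... | false = refl

  0≤indicator*indicator : ∀ b c → + 0 ≤ indicator b * indicator c
  0≤indicator*indicator true  true  = +≤+ z≤n
  0≤indicator*indicator true  false = +≤+ z≤n
  0≤indicator*indicator false _     = +≤+ z≤n

  card≡sumFin-indicator : ∀ {m} (C : Subset m) → + ∣ C ∣ ≡ sumFin (λ i → indicator (lookup C i))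
  card≡sumFin-indicator []          = refl
  card≡sumFin-indicator (true ∷ C)  = cong (λ z → + 1 + z) (card≡sumFin-indicator C)
  card≡sumFin-indicator (false ∷ C) = trans (card≡sumFin-indicator C) (sym (ℤ.+-identityˡ _))

  δᵇ : Bool → ℤ
  δᵇ b = if b then - + 1 else + 1

  δ-∈ : ∀ {m} {T : Subset m} {i} → i ∈ T → δ T i ≡ - + 1
  δ-∈ i∈T rewrite Vec.[]=⇒lookup i∈T = refl

  δ-∉ : ∀ {m} {T : Subset m} {i} → i ∉ T → δ T i ≡ + 1
  δ-∉ {T = T} {i} i∉T with lookup T i in eq
  ... | true  = ⊥-elim (i∉T (Vec.lookup⇒[]= i T eq))
  ... | false = refl

  δ*δ≡1 : ∀ {m} (T : Subset m) i → δ T i * δ T i ≡ + 1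
  δ*δ≡1 T i with lookup T i
  ... | true  = refl
  ... | false = refl

  ∣δ*x∣≡∣x∣ : ∀ {m} (T : Subset m) i x → ℤ.∣ δ T i * x ∣ ≡ ℤ.∣ x ∣
  ∣δ*x∣≡∣x∣ T i x with lookup T i
  ... | true  = trans (cong ℤ.∣_∣ (sym (ℤ.neg-distribˡ-* (+ 1) x)))
                      (trans (ℤ.∣-i∣≡∣i∣ (+ 1 * x)) (cong ℤ.∣_∣ (ℤ.*-identityˡ x)))
  ... | false = cong ℤ.∣_∣ (ℤ.*-identityˡ x)

  +*-pos : ∀ a {v} → 0 ℕ.< a → + 0 < v → + 0 < + a * v
  +*-pos (suc a) {+ suc v} _ _        = +<+ (s≤s z≤n)
  +*-pos (suc a) {+ zero}  _ (+<+ ())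

  +*-nonneg : ∀ a {v} → + 0 ≤ v → + 0 ≤ + a * v
  +*-nonneg a {v} 0≤v = ℤ.≤-trans (ℤ.≤-reflexive (sym (ℤ.*-zeroʳ (+ a)))) (ℤ.*-monoˡ-≤-nonNeg (+ a) 0≤v)

  +*-cancel-nonneg : ∀ m {a} → 1 ℕ.≤ m → + 0 ≤ + m * a → + 0 ≤ a
  +*-cancel-nonneg (suc m) {a} _ 0≤ma =
    ℤ.*-cancelˡ-≤-pos (+ 0) a (+ suc m) (subst (_≤ + suc m * a) (sym (ℤ.*-zeroʳ (+ suc m))) 0≤ma)

  +*-cancel-nonpos : ∀ m {a} → 1 ℕ.≤ m → + m * a ≤ + 0 → a ≤ + 0
  +*-cancel-nonpos (suc m) {a} _ ma≤0 =
    ℤ.*-cancelˡ-≤-pos a (+ 0) (+ suc m) (subst (+ suc m * a ≤_) (sym (ℤ.*-zeroʳ (+ suc m))) ma≤0)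

  %2-of-double+ : ∀ c {A} r → + 0 ≤ A → + c ≡ A + A + + r → c % 2 ≡ r % 2
  %2-of-double+ c {A} r 0≤A c≡ = trans (cong (_% 2) (ℤ.+-injective (begin
    + c                          ≡⟨ c≡ ⟩
    A + A + + r                  ≡⟨ cong (λ B → B + B + + r) (ℤ.0≤i⇒+∣i∣≡i 0≤A) ⟨
    + a + + a + + r              ≡⟨ ℤ.+-comm (+ a + + a) (+ r) ⟩
    + r + (+ a + + a)            ≡⟨ cong (λ B → + r + B) (ℤ.pos-+ a a) ⟨
    + r + + (a ℕ.+ a)            ≡⟨ ℤ.pos-+ r (a ℕ.+ a) ⟨
    + (r ℕ.+ (a ℕ.+ a))          ≡⟨ cong (λ b → + (r ℕ.+ b)) a+a≡a*2 ⟩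
    + (r ℕ.+ a ℕ.* 2)            ∎)))
    ([m+kn]%n≡m%n r a 2)
    where
    open ≡-Reasoning
    a = ℤ.∣ A ∣
    a+a≡a*2 : a ℕ.+ a ≡ a ℕ.* 2
    a+a≡a*2 = trans (cong (a ℕ.+_) (sym (ℕ.+-identityʳ a))) (ℕ.*-comm 2 a)

-- Cyclic indices

x≡q*x⇒x≡0 : ∀ {x q} → 1 ℕ.< q → x ≡ q ℕ.* x → x ≡ 0
x≡q*x⇒x≡0 {zero}          _   _  = refl
x≡q*x⇒x≡0 {suc x} {q} 1<q eq = ⊥-elim (ℕ.<-irrefl eq
  (ℕ.<-≤-trans (ℕ.m<m*n (suc x) q 1<q) (ℕ.≤-reflexive (ℕ.*-comm (suc x) q))))

module _ (n : ℕ) {{_ : NonZero n}} where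

  private
    [a%n+b]%n≡[a+b]%n : ∀ a b → (a % n ℕ.+ b) % n ≡ (a ℕ.+ b) % n
    [a%n+b]%n≡[a+b]%n a b = begin
      (a % n ℕ.+ b) % n          ≡⟨ %-distribˡ-+ (a % n) b n ⟩
      (a % n % n ℕ.+ b % n) % n  ≡⟨ cong (λ z → (z ℕ.+ b % n) % n) (m%n%n≡m%n a n) ⟩
      (a % n ℕ.+ b % n) % n      ≡⟨ %-distribˡ-+ a b n ⟨
      (a ℕ.+ b) % n              ∎
      where open ≡-Reasoning

  toℕ-shift : ∀ i a → toℕ (shift n i a) ≡ (toℕ i ℕ.+ a) % n
  toℕ-shift i a = Fin.toℕ-fromℕ< _

  shift-zero : ∀ i → shift n i 0 ≡ i
  shift-zero i = Fin.toℕ-injective (begin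
    toℕ (shift n i 0)    ≡⟨ toℕ-shift i 0 ⟩
    (toℕ i ℕ.+ 0) % n    ≡⟨ cong (_% n) (ℕ.+-identityʳ (toℕ i)) ⟩
    toℕ i % n            ≡⟨ m<n⇒m%n≡m (Fin.toℕ<n i) ⟩
    toℕ i                ∎)
    where open ≡-Reasoning

  shift-shift : ∀ i a b → shift n (shift n i a) b ≡ shift n i (a ℕ.+ b)
  shift-shift i a b = Fin.toℕ-injective (begin
    toℕ (shift n (shift n i a) b)  ≡⟨ toℕ-shift _ b ⟩
    (toℕ (shift n i a) ℕ.+ b) % n  ≡⟨ cong (λ z → (z ℕ.+ b) % n) (toℕ-shift i a) ⟩
    ((toℕ i ℕ.+ a) % n ℕ.+ b) % n  ≡⟨ [a%n+b]%n≡[a+b]%n (toℕ i ℕ.+ a) b ⟩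
    (toℕ i ℕ.+ a ℕ.+ b) % n        ≡⟨ cong (_% n) (ℕ.+-assoc (toℕ i) a b) ⟩
    (toℕ i ℕ.+ (a ℕ.+ b)) % n      ≡⟨ toℕ-shift i (a ℕ.+ b) ⟨
    toℕ (shift n i (a ℕ.+ b))      ∎)
    where open ≡-Reasoning

  shift-+n : ∀ i a → shift n i (a ℕ.+ n) ≡ shift n i a
  shift-+n i a = Fin.toℕ-injective (begin
    toℕ (shift n i (a ℕ.+ n))  ≡⟨ toℕ-shift i _ ⟩
    (toℕ i ℕ.+ (a ℕ.+ n)) % n  ≡⟨ cong (_% n) (ℕ.+-assoc (toℕ i) a n) ⟨
    (toℕ i ℕ.+ a ℕ.+ n) % n    ≡⟨ [m+n]%n≡m%n (toℕ i ℕ.+ a) n ⟩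
    (toℕ i ℕ.+ a) % n          ≡⟨ toℕ-shift i a ⟨
    toℕ (shift n i a)          ∎)
    where open ≡-Reasoning

  shift-n : ∀ i → shift n i n ≡ i
  shift-n i = trans (shift-+n i 0) (shift-zero i)

  suc[n∸1]≡n : suc (n ∸ 1) ≡ n
  suc[n∸1]≡n = ℕ.m+[n∸m]≡n (ℕ.>-nonZero⁻¹ n)

  next-prev : ∀ i → next n (prev n i) ≡ i
  next-prev i = trans (shift-shift i (n ∸ 1) 1)
    (trans (cong (shift n i) (trans (ℕ.+-comm (n ∸ 1) 1) suc[n∸1]≡n)) (shift-n i))

  prev-next : ∀ i → prev n (next n i) ≡ i
  prev-next i = trans (shift-shift i 1 (n ∸ 1)) (trans (cong (shift n i) suc[n∸1]≡n) (shift-n i))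

  next-shift : ∀ i a → next n (shift n i a) ≡ shift n i (suc a)
  next-shift i a = trans (shift-shift i a 1) (cong (shift n i) (ℕ.+-comm a 1))

  prev-shift : ∀ i a → prev n (shift n i (suc a)) ≡ shift n i a
  prev-shift i a = trans (cong (prev n) (sym (next-shift i a))) (prev-next (shift n i a))

  shift-surjective : ∀ d k → Σ ℕ λ j → j ℕ.< n × shift n d j ≡ k
  shift-surjective d k = j , m%n<n _ n , Fin.toℕ-injective (begin
    toℕ (shift n d j)                      ≡⟨ toℕ-shift d j ⟩
    (toℕ d ℕ.+ j) % n                      ≡⟨ cong (_% n) (ℕ.+-comm (toℕ d) j) ⟩
    (j ℕ.+ toℕ d) % n                      ≡⟨ [a%n+b]%n≡[a+b]%n (n ∸ toℕ d ℕ.+ toℕ k) (toℕ d) ⟩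
    (n ∸ toℕ d ℕ.+ toℕ k ℕ.+ toℕ d) % n    ≡⟨ cong (_% n) wrap ⟩
    (toℕ k ℕ.+ n) % n                      ≡⟨ [m+n]%n≡m%n (toℕ k) n ⟩
    toℕ k % n                              ≡⟨ m<n⇒m%n≡m (Fin.toℕ<n k) ⟩
    toℕ k                                  ∎)
    where
    open ≡-Reasoning
    j = (n ∸ toℕ d ℕ.+ toℕ k) % n
    wrap : n ∸ toℕ d ℕ.+ toℕ k ℕ.+ toℕ d ≡ toℕ k ℕ.+ n
    wrap = begin
      n ∸ toℕ d ℕ.+ toℕ k ℕ.+ toℕ d    ≡⟨ ℕ.+-assoc (n ∸ toℕ d) (toℕ k) (toℕ d) ⟩
      n ∸ toℕ d ℕ.+ (toℕ k ℕ.+ toℕ d)  ≡⟨ cong (n ∸ toℕ d ℕ.+_) (ℕ.+-comm (toℕ k) (toℕ d)) ⟩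
      n ∸ toℕ d ℕ.+ (toℕ d ℕ.+ toℕ k)  ≡⟨ ℕ.+-assoc (n ∸ toℕ d) (toℕ d) (toℕ k) ⟨
      n ∸ toℕ d ℕ.+ toℕ d ℕ.+ toℕ k    ≡⟨ cong (ℕ._+ toℕ k) (ℕ.m∸n+n≡m (ℕ.<⇒≤ (Fin.toℕ<n d))) ⟩
      n ℕ.+ toℕ k                      ≡⟨ ℕ.+-comm n (toℕ k) ⟩
      toℕ k ℕ.+ n                      ∎

  prev-permutation : Permutation′ n
  prev-permutation = permutation (prev n) (next n) prev-next next-prev

  δeq-prev : ∀ (i k : Fin n) → δeq (prev n i) k ≡ δeq i (next n k)
  δeq-prev i k with i Fin.≟ next n k
  ... | yes refl = trans (cong (λ j → δeq j k) (prev-next k))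
                         (trans (δeq-refl k) (sym (δeq-refl (next n k))))
  ... | no i≢k+1 = trans (δeq-≢ (λ i-1≡k → i≢k+1 (trans (sym (next-prev i)) (cong (next n) i-1≡k))))
                         (sym (δeq-≢ i≢k+1))

  ∣∣-scaling-along-shift : ∀ {q} (u : Fin n → ℤ) → (∀ k → ℤ.∣ u k ∣ ≡ q ℕ.* ℤ.∣ u (next n k) ∣) →
                           ∀ a k → ℤ.∣ u k ∣ ≡ q ℕ.^ a ℕ.* ℤ.∣ u (shift n k a) ∣
  ∣∣-scaling-along-shift u scale zero    k = sym (trans (ℕ.*-identityˡ _) (cong (λ j → ℤ.∣ u j ∣) (shift-zero k)))
  ∣∣-scaling-along-shift {q} u scale (suc a) k = begin
    ℤ.∣ u k ∣
      ≡⟨ ∣∣-scaling-along-shift u scale a k ⟩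
    q ℕ.^ a ℕ.* ℤ.∣ u (shift n k a) ∣
      ≡⟨ cong (q ℕ.^ a ℕ.*_) (scale (shift n k a)) ⟩
    q ℕ.^ a ℕ.* (q ℕ.* ℤ.∣ u (next n (shift n k a)) ∣)
      ≡⟨ ℕ.*-assoc (q ℕ.^ a) q _ ⟨
    q ℕ.^ a ℕ.* q ℕ.* ℤ.∣ u (next n (shift n k a)) ∣
      ≡⟨ cong₂ ℕ._*_ (ℕ.*-comm (q ℕ.^ a) q) (cong (λ j → ℤ.∣ u j ∣) (next-shift k a)) ⟩
    q ℕ.^ suc a ℕ.* ℤ.∣ u (shift n k (suc a)) ∣ ∎
    where open ≡-Reasoning

  ∣∣-scaling-cycle⇒≡0 : ∀ {q} → 1 ℕ.< q → (u : Fin n → ℤ) →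
                        (∀ k → ℤ.∣ u k ∣ ≡ q ℕ.* ℤ.∣ u (next n k) ∣) → ∀ k → u k ≡ + 0
  ∣∣-scaling-cycle⇒≡0 {q} 1<q u scale k = ℤ.∣i∣≡0⇒i≡0 (x≡q*x⇒x≡0 (ℕ.^-monoʳ-< q 1<q (ℕ.>-nonZero⁻¹ n))
    (trans (∣∣-scaling-along-shift u scale n k) (cong (λ j → q ℕ.^ n ℕ.* ℤ.∣ u j ∣) (shift-n k))))

  scaling-cycle⇒≡0 : ∀ {q} → 1 ℕ.< q → (u : Fin n → ℤ) → (∀ k → u k ≡ + q * u (next n k)) → ∀ k → u k ≡ + 0
  scaling-cycle⇒≡0 {q} 1<q u scale =
    ∣∣-scaling-cycle⇒≡0 1<q u (λ k → trans (cong ℤ.∣_∣ (scale k)) (ℤ.abs-* (+ q) (u (next n k))))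

-- The forms F_T^{(d)}

module _ (n : ℕ) {{_ : NonZero n}} (p : ℕ) where
  open import Data.Integer using (_≤_)

  F-rotate : ∀ T d (x : Fin n → ℤ) →
             F n p T d x + + (p ℕ.^ n) * (δ T d * x d) ≡ δ T d * x d + + p * F n p T (next n d) x
  F-rotate T d x = begin
    F n p T d x + + (p ℕ.^ n) * y d
      ≡⟨ cong (λ i → F n p T d x + + (p ℕ.^ n) * y i) (shift-n n d) ⟨
    sumℕ n (λ j → + (p ℕ.^ j) * h j) + + (p ℕ.^ n) * h n
      ≡⟨ sumℕ-geometric-shift p n h ⟩
    h 0 + + p * sumℕ n (λ j → + (p ℕ.^ j) * h (suc j))
      ≡⟨ cong₂ (λ i s → y i + + p * s) (shift-zero n d)
               (sumℕ-cong n λ j → cong (λ i → + (p ℕ.^ j) * y i) (sym (shift-shift n d 1 j))) ⟩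
    y d + + p * F n p T (next n d) x ∎
    where
    open ≡-Reasoning
    y : Fin n → ℤ
    y k = δ T k * x k
    h : ℕ → ℤ
    h j = y (shift n d j)

  F-cong : ∀ T d {x y : Fin n → ℤ} → (∀ k → x k ≡ y k) → F n p T d x ≡ F n p T d y
  F-cong T d x≗y = sumℕ-cong n (λ j → cong (λ z → + (p ℕ.^ j) * (δ T (shift n d j) * z)) (x≗y (shift n d j)))

  F-linear : ∀ T d a b (x y : Fin n → ℤ) → F n p T d (λ k → a * x k + b * y k) ≡ a * F n p T d x + b * F n p T d y
  F-linear T d a b x y = begin
    F n p T d (λ k → a * x k + b * y k)
      ≡⟨ sumℕ-cong n (λ j → distrib a b (+ (p ℕ.^ j)) (δ T (shift n d j)) _ _) ⟩
    sumℕ n (λ j → a * term x j + b * term y j)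
      ≡⟨ sumℕ-distrib-+ n _ _ ⟩
    sumℕ n (λ j → a * term x j) + sumℕ n (λ j → b * term y j)
      ≡⟨ cong₂ _+_ (*-distribˡ-sumℕ n a (term x)) (*-distribˡ-sumℕ n b (term y)) ⟨
    a * F n p T d x + b * F n p T d y ∎
    where
    open ≡-Reasoning
    term : (Fin n → ℤ) → ℕ → ℤ
    term z j = + (p ℕ.^ j) * (δ T (shift n d j) * z (shift n d j))
    distrib : ∀ a b q s u v → q * (s * (a * u + b * v)) ≡ a * (q * (s * u)) + b * (q * (s * v))
    distrib = solve-∀

  F-scale : ∀ T d a (x : Fin n → ℤ) → F n p T d (λ k → a * x k) ≡ a * F n p T d x
  F-scale T d a x = trans (sumℕ-cong n (λ j → pull (+ (p ℕ.^ j)) (δ T (shift n d j)) a (x (shift n d j))))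
                          (sym (*-distribˡ-sumℕ n a _))
    where
    pull : ∀ q s a x → q * (s * (a * x)) ≡ a * (q * (s * x))
    pull = solve-∀

  F-lower-bound : ∀ T (y : Fin n → ℤ) M → (∀ k → - M ≤ δ T k * y k) →
                  ∀ r → - (M * sumℕ n (λ j → + (p ℕ.^ j))) ≤ F n p T r y
  F-lower-bound T y M -M≤y r = ℤ.≤-trans
    (ℤ.≤-reflexive (trans (ℤ.neg-distribˡ-* M _) (*-distribˡ-sumℕ n (- M) _)))
    (sumℕ-mono-≤ n (λ j → ℤ.≤-trans (ℤ.≤-reflexive (ℤ.*-comm (- M) (+ (p ℕ.^ j))))
                                    (ℤ.*-monoˡ-≤-nonNeg (+ (p ℕ.^ j)) (-M≤y (shift n r j)))))

module _ (n : ℕ) {{_ : NonZero n}} {p : ℕ} (1<p : 1 ℕ.< p) where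
  open import Data.Integer using (_≤_; _<_)

  F-coboundary : ∀ T (x w : Fin n → ℤ) → (∀ k → δ T k * x k ≡ w k - + p * w (next n k)) →
                 ∀ d → F n p T d x ≡ (+ 1 - + (p ℕ.^ n)) * w d
  F-coboundary T x w δx≡∂w d = ℤ.i-j≡0⇒i≡j _ _ (scaling-cycle⇒≡0 n 1<p u u-scales d)
    where
    Q = + (p ℕ.^ n)
    u : Fin n → ℤ
    u k = F n p T k x - (+ 1 - Q) * w k
    u-scales : ∀ k → u k ≡ + p * u (next n k)
    u-scales k = begin
      Fk - (+ 1 - Q) * w k
        ≡⟨ detach Fk Q (δ T k * x k) (w k) ⟩
      Fk + Q * (δ T k * x k) - Q * (δ T k * x k) - (+ 1 - Q) * w k
        ≡⟨ cong (λ z → z - Q * (δ T k * x k) - (+ 1 - Q) * w k) (F-rotate n p T k x) ⟩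
      δ T k * x k + + p * Fk′ - Q * (δ T k * x k) - (+ 1 - Q) * w k
        ≡⟨ cong (λ z → z + + p * Fk′ - Q * z - (+ 1 - Q) * w k) (δx≡∂w k) ⟩
      ∂w + + p * Fk′ - Q * ∂w - (+ 1 - Q) * w k
        ≡⟨ collect Fk′ Q (+ p) (w k) (w (next n k)) ⟩
      + p * (Fk′ - (+ 1 - Q) * w (next n k)) ∎
      where
      open ≡-Reasoning
      Fk = F n p T k x
      Fk′ = F n p T (next n k) x
      ∂w = w k - + p * w (next n k)
      detach : ∀ f q y v → f - (+ 1 - q) * v ≡ f + q * y - q * y - (+ 1 - q) * v
      detach = solve-∀
      collect : ∀ f′ q r v v′ → v - r * v′ + r * f′ - q * (v - r * v′) - (+ 1 - q) * v ≡ r * (f′ - (+ 1 - q) * v′)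
      collect = solve-∀

  F-pos : ∀ T (y : Fin n → ℤ) s → (∀ k → + 0 ≤ δ T k * y k) → + 0 < δ T s * y s → ∀ r → + 0 < F n p T r y
  F-pos T y s 0≤y 0<ys r with shift-surjective n r s
  ... | j , j<n , refl = ℤ.<-≤-trans (+*-pos (p ℕ.^ j) (p^j>0 j) 0<ys)
                                     (term≤sumℕ n (λ i → +*-nonneg (p ℕ.^ i) (0≤y (shift n r i))) j j<n)
    where
    p^j>0 : ∀ j → 0 ℕ.< p ℕ.^ j
    p^j>0 = ℕ.m^n>0 p {{ℕ.>-nonZero (ℕ.<-trans (s≤s z≤n) 1<p)}}

  1<p^n : 1 ℕ.< p ℕ.^ n
  1<p^n = ℕ.^-monoʳ-< p 1<p (ℕ.>-nonZero⁻¹ n)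

  +[p^n∸1]≡+p^n-1 : + (p ℕ.^ n ∸ 1) ≡ + (p ℕ.^ n) - + 1
  +[p^n∸1]≡+p^n-1 = sym (trans (ℤ.[+m]-[+n]≡m⊖n (p ℕ.^ n) 1) (ℤ.⊖-≥ (ℕ.<⇒≤ 1<p^n)))

  F-two-point-pos : ∀ T (y : Fin n → ℤ) i j {a b} → (∀ k → δ T k * y k ≡ δeq i k * a + δeq j k * b) →
                    + 0 < a → + 0 ≤ b → ∀ r → + 0 < F n p T r y
  F-two-point-pos T y i j {a} {b} y≡ 0<a 0≤b = F-pos T y i 0≤y 0<yi
    where
    0≤y : ∀ k → + 0 ≤ δ T k * y k
    0≤y k = subst (+ 0 ≤_) (sym (y≡ k))
      (ℤ.+-mono-≤ (δeq-*-lower i k ℤ.≤-refl (ℤ.<⇒≤ 0<a)) (δeq-*-lower j k ℤ.≤-refl 0≤b))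
    0<yi : + 0 < δ T i * y i
    0<yi = subst (+ 0 <_) (sym (y≡ i)) (ℤ.<-≤-trans
      (subst (+ 0 <_) (sym (trans (cong (_* a) (δeq-refl i)) (ℤ.*-identityˡ a))) 0<a)
      (ℤ.≤-trans (ℤ.≤-reflexive (sym (ℤ.+-identityʳ _)))
                 (ℤ.+-monoʳ-≤ (δeq i i * a) (δeq-*-lower j i ℤ.≤-refl 0≤b))))

  F-two-point-neg : ∀ T (y : Fin n → ℤ) i j {a b} → (∀ k → δ T k * y k ≡ δeq i k * a + δeq j k * b) →
                    a < + 0 → b ≤ + 0 → ∀ r → F n p T r y < + 0
  F-two-point-neg T y i j {a} {b} y≡ a<0 b≤0 r = ℤ.neg-cancel-< (subst (+ 0 <_) F[-y]≡-F[y]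
    (F-two-point-pos T (λ k → - + 1 * y k) i j δ*[-y]≡ (ℤ.neg-mono-< a<0) (ℤ.neg-mono-≤ b≤0) r))
    where
    F[-y]≡-F[y] : F n p T r (λ k → - + 1 * y k) ≡ - F n p T r y
    F[-y]≡-F[y] = trans (F-scale n p T r (- + 1) y) (ℤ.-1*i≡-i _)
    negate : ∀ t y → t * (- + 1 * y) ≡ - + 1 * (t * y)
    negate = solve-∀
    negate′ : ∀ e e′ a b → - + 1 * (e * a + e′ * b) ≡ e * - a + e′ * - b
    negate′ = solve-∀
    δ*[-y]≡ : ∀ k → δ T k * (- + 1 * y k) ≡ δeq i k * - a + δeq j k * - b
    δ*[-y]≡ k = trans (negate (δ T k) (y k)) (trans (cong (- + 1 *_) (y≡ k)) (negate′ (δeq i k) (δeq j k) a b))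

  [1-p^n]*v≤0 : ∀ {v} → + 0 ≤ v → (+ 1 - + (p ℕ.^ n)) * v ≤ + 0
  [1-p^n]*v≤0 {v} 0≤v = subst (_≤ + 0) (sym [1-p^n]*v≡) (ℤ.neg-mono-≤ (+*-nonneg (p ℕ.^ n ∸ 1) 0≤v))
    where
    one-minus : ∀ q → + 1 - q ≡ - (q - + 1)
    one-minus = solve-∀
    [1-p^n]*v≡ : (+ 1 - + (p ℕ.^ n)) * v ≡ - (+ (p ℕ.^ n ∸ 1) * v)
    [1-p^n]*v≡ = trans (cong (_* v) (trans (one-minus (+ (p ℕ.^ n))) (cong -_ (sym +[p^n∸1]≡+p^n-1))))
                       (sym (ℤ.neg-distribˡ-* (+ (p ℕ.^ n ∸ 1)) v))

-- Combinations of the haᵢ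

module _ (n : ℕ) {{_ : NonZero n}} (p : ℕ) (S : Subset n) where
  open import Data.Integer using (_≤_)

  haSum : (Fin n → ℤ) → Fin n → ℤ
  haSum c k = - (δ S k * c k) - + p * c (next n k)

  sumFin-*ha : ∀ c k → sumFin (λ i → c i * ha n p S i k) ≡ haSum c k
  sumFin-*ha c k = begin
    sumFin (λ i → c i * ha n p S i k)
      ≡⟨ sumFin-cong (λ i → trans (cong (λ e → c i * (- (δ S i * δeq i k) + - (+ p * e))) (δeq-prev n i k))
                                 (expand (c i) (δ S i) (δeq i k) (δeq i (next n k)) (+ p))) ⟩
    sumFin (λ i → - (c i * δ S i) * δeq i k + - (+ p * c i) * δeq i (next n k))
      ≡⟨ sumFin-distrib-+ (λ i → - (c i * δ S i) * δeq i k) (λ i → - (+ p * c i) * δeq i (next n k)) ⟩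
    sumFin (λ i → - (c i * δ S i) * δeq i k) + sumFin (λ i → - (+ p * c i) * δeq i (next n k))
      ≡⟨ cong₂ _+_ (sumFin-δeq (λ i → - (c i * δ S i)) k) (sumFin-δeq (λ i → - (+ p * c i)) (next n k)) ⟩
    - (c k * δ S k) + - (+ p * c (next n k))
      ≡⟨ tidy (c k) (δ S k) (+ p) (c (next n k)) ⟩
    haSum c k ∎
    where
    open ≡-Reasoning
    expand : ∀ c s e e′ q → c * (- (s * e) + - (q * e′)) ≡ - (c * s) * e + - (q * c) * e′
    expand = solve-∀
    tidy : ∀ c s q c′ → - (c * s) + - (q * c′) ≡ - (s * c) - q * c′
    tidy = solve-∀

  ha≡haSum-δeq : ∀ i k → ha n p S i k ≡ haSum (δeq i) k
  ha≡haSum-δeq i k = cong₂ (λ a b → - a + - (+ p * b)) (δeq-swap (δ S) i k) (δeq-prev n i k)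

  haSum-linear : ∀ a b c d k → haSum (λ j → a * c j + b * d j) k ≡ a * haSum c k + b * haSum d k
  haSum-linear a b c d k = distrib a b (c k) (d k) (c (next n k)) (d (next n k)) (δ S k) (+ p)
    where
    distrib : ∀ a b x y x′ y′ s q →
              - (s * (a * x + b * y)) - q * (a * x′ + b * y′) ≡ a * (- (s * x) - q * x′) + b * (- (s * y) - q * y′)
    distrib = solve-∀

  haSum-scale : ∀ a c k → haSum (λ j → a * c j) k ≡ a * haSum c k
  haSum-scale a c k = distrib a (c k) (c (next n k)) (δ S k) (+ p)
    where
    distrib : ∀ a x x′ s q → - (s * (a * x)) - q * (a * x′) ≡ a * (- (s * x) - q * x′)
    distrib = solve-∀

  pHaCone-intro : ∀ c → (∀ s → s ∈ S → + 0 ≤ c s) → ∀ x → (∀ k → x k ≡ haSum c k) → pHaCone n p S x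
  pHaCone-intro c 0≤c x x≡ = 1 , s≤s z≤n , c , 0≤c ,
    λ k → trans (ℤ.*-identityˡ (x k)) (trans (x≡ k) (sym (sumFin-*ha c k)))

module _ (n : ℕ) {{_ : NonZero n}} {p : ℕ} (1<p : 1 ℕ.< p) (S : Subset n) where
  open import Data.Integer using (_≤_)

  haSum-injective : ∀ d → (∀ k → haSum n p S d k ≡ + 0) → ∀ k → d k ≡ + 0
  haSum-injective d haSum≡0 = ∣∣-scaling-cycle⇒≡0 n 1<p d λ k → begin
    ℤ.∣ d k ∣                           ≡⟨ ∣δ*x∣≡∣x∣ S k (d k) ⟨
    ℤ.∣ δ S k * d k ∣                   ≡⟨ cong ℤ.∣_∣ (δd≡ k) ⟩
    ℤ.∣ - (+ p * d (next n k)) ∣        ≡⟨ ℤ.∣-i∣≡∣i∣ (+ p * d (next n k)) ⟩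
    ℤ.∣ + p * d (next n k) ∣            ≡⟨ ℤ.abs-* (+ p) (d (next n k)) ⟩
    p ℕ.* ℤ.∣ d (next n k) ∣            ∎
    where
    open ≡-Reasoning
    δd≡ : ∀ k → δ S k * d k ≡ - (+ p * d (next n k))
    δd≡ k = trans (sym (ℤ.neg-involutive _)) (cong -_ (ℤ.i-j≡0⇒i≡j _ _ (haSum≡0 k)))

  pHaCone-coefficients-nonneg : ∀ {x} → pHaCone n p S x → ∀ c → (∀ k → x k ≡ haSum n p S c k) →
                                ∀ s → s ∈ S → + 0 ≤ c s
  pHaCone-coefficients-nonneg {x} (m , 1≤m , c′ , 0≤c′ , mx≡) c x≡ s s∈S =
    +*-cancel-nonneg m 1≤m (subst (+ 0 ≤_) (c′≡mc s) (0≤c′ s s∈S))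
    where
    d : Fin n → ℤ
    d j = + 1 * c′ j + - + m * c j
    haSum-d≡0 : ∀ k → haSum n p S d k ≡ + 0
    haSum-d≡0 k = begin
      haSum n p S d k
        ≡⟨ haSum-linear n p S (+ 1) (- + m) c′ c k ⟩
      + 1 * haSum n p S c′ k + - + m * haSum n p S c k
        ≡⟨ cong₂ (λ a b → + 1 * a + - + m * b) (trans (sym (sumFin-*ha n p S c′ k)) (sym (mx≡ k))) (sym (x≡ k)) ⟩
      + 1 * (+ m * x k) + - + m * x k
        ≡⟨ cancel (+ m) (x k) ⟩
      + 0 ∎
      where
      open ≡-Reasoning
      cancel : ∀ a b → + 1 * (a * b) + - a * b ≡ + 0
      cancel = solve-∀
    c′≡mc : ∀ j → c′ j ≡ + m * c j
    c′≡mc j = trans (sym (undo (c′ j) (+ m) (c j)))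
                    (trans (cong (_+ + m * c j) (haSum-injective d haSum-d≡0 j)) (ℤ.+-identityˡ _))
      where
      undo : ∀ a b e → + 1 * a + - b * e + b * e ≡ a
      undo = solve-∀

-- Comparing the cones

SignRule : (n : ℕ) {{_ : NonZero n}} → Subset n → Subset n → Set
SignRule n S T = ∀ k → δ T k * δ S k ≡ - δ T (prev n k)

module _ (n : ℕ) {{_ : NonZero n}} {p : ℕ} (1<p : 1 ℕ.< p) (S T : Subset n) where
  open import Data.Integer using (_≤_)

  F-haSum : ∀ c → (∀ k → δ T k * δ S k * c k ≡ - δ T (prev n k) * c k) →
            ∀ d → F n p T d (haSum n p S c) ≡ (+ 1 - + (p ℕ.^ n)) * (δ T (prev n d) * c d)
  F-haSum c rule = F-coboundary n 1<p T (haSum n p S c) (λ k → δ T (prev n k) * c k) λ k → begin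
    δ T k * (- (δ S k * c k) - + p * c (next n k))
      ≡⟨ distrib (δ T k) (δ S k) (c k) (+ p) (c (next n k)) ⟩
    - (δ T k * δ S k * c k) - + p * (δ T k * c (next n k))
      ≡⟨ cong₂ (λ a j → - a - + p * (δ T j * c (next n k))) (rule k) (sym (prev-next n k)) ⟩
    - (- δ T (prev n k) * c k) - + p * (δ T (prev n (next n k)) * c (next n k))
      ≡⟨ cong (_- + p * (δ T (prev n (next n k)) * c (next n k))) (neg-neg (δ T (prev n k)) (c k)) ⟩
    δ T (prev n k) * c k - + p * (δ T (prev n (next n k)) * c (next n k)) ∎
    where
    open ≡-Reasoning
    distrib : ∀ t s c q c′ → t * (- (s * c) - q * c′) ≡ - (t * s * c) - q * (t * c′)
    distrib = solve-∀
    neg-neg : ∀ a c → - (- a * c) ≡ a * c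
    neg-neg = solve-∀

  haSum-of-F : SignRule n S T → ∀ x k →
               haSum n p S (λ j → - (δ T (prev n j) * F n p T j x)) k ≡ (+ (p ℕ.^ n) - + 1) * x k
  haSum-of-F rule x k = begin
    - (δ S k * - (δ T (prev n k) * Fk)) - + p * - (δ T (prev n (next n k)) * Fk′)
      ≡⟨ cong₂ (λ t j → - (δ S k * - (t * Fk)) - + p * - (δ T j * Fk′)) δT[k-1]≡ (prev-next n k) ⟩
    - (δ S k * - (- (δ T k * δ S k) * Fk)) - + p * - (δ T k * Fk′)
      ≡⟨ factor (δ T k) (δ S k) Fk Fk′ (+ p) ⟩
    δ T k * (+ p * Fk′ - (δ S k * δ S k) * Fk)
      ≡⟨ cong (λ s → δ T k * (+ p * Fk′ - s * Fk)) (δ*δ≡1 S k) ⟩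
    δ T k * (+ p * Fk′ - + 1 * Fk)
      ≡⟨ cong (δ T k *_) rotated ⟩
    δ T k * (Q * y - y)
      ≡⟨ factor′ (δ T k) Q (x k) ⟩
    (δ T k * δ T k) * ((Q - + 1) * x k)
      ≡⟨ cong (_* ((Q - + 1) * x k)) (δ*δ≡1 T k) ⟩
    + 1 * ((Q - + 1) * x k)
      ≡⟨ ℤ.*-identityˡ _ ⟩
    (Q - + 1) * x k ∎
    where
    open ≡-Reasoning
    Q = + (p ℕ.^ n)
    Fk = F n p T k x
    Fk′ = F n p T (next n k) x
    y = δ T k * x k
    δT[k-1]≡ : δ T (prev n k) ≡ - (δ T k * δ S k)
    δT[k-1]≡ = trans (sym (ℤ.neg-involutive _)) (cong -_ (sym (rule k)))
    factor : ∀ t s f f′ q → - (s * - (- (t * s) * f)) - q * - (t * f′) ≡ t * (q * f′ - (s * s) * f)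
    factor = solve-∀
    factor′ : ∀ t q x → t * (q * (t * x) - t * x) ≡ (t * t) * ((q - + 1) * x)
    factor′ = solve-∀
    rotated : + p * Fk′ - + 1 * Fk ≡ Q * y - y
    rotated = begin
      + p * Fk′ - + 1 * Fk   ≡⟨ shuffle Fk Fk′ y (+ p) ⟩
      y + + p * Fk′ - y - Fk ≡⟨ cong (λ z → z - y - Fk) (F-rotate n p T k x) ⟨
      Fk + Q * y - y - Fk    ≡⟨ shuffle′ Fk Q y ⟩
      Q * y - y              ∎
      where
      shuffle : ∀ f f′ y q → q * f′ - + 1 * f ≡ y + q * f′ - y - f
      shuffle = solve-∀
      shuffle′ : ∀ f q y → f + q * y - y - f ≡ q * y - y
      shuffle′ = solve-∀

  signRule⇒cones-agree : SignRule n S T → (∀ s → s ∈ S → prev n s ∉ T) →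
                         ∀ x → HomCone n p S T x ⇔ pHaCone n p S x
  signRule⇒cones-agree rule prev∉T x = mk⇔ hom⇒pHa pHa⇒hom
    where
    hom⇒pHa : HomCone n p S T x → pHaCone n p S x
    hom⇒pHa F≤0 = p ℕ.^ n ∸ 1 , ℕ.∸-monoˡ-≤ 1 (1<p^n n 1<p) , c , 0≤c , mx≡
      where
      c : Fin n → ℤ
      c k = - (δ T (prev n k) * F n p T k x)
      0≤c : ∀ s → s ∈ S → + 0 ≤ c s
      0≤c s s∈S rewrite δ-∉ (prev∉T s s∈S) | ℤ.*-identityˡ (F n p T s x) = ℤ.neg-mono-≤ (F≤0 s s∈S)
      mx≡ : ∀ k → + (p ℕ.^ n ∸ 1) * x k ≡ sumFin (λ i → c i * ha n p S i k)
      mx≡ k = trans (cong (_* x k) (+[p^n∸1]≡+p^n-1 n 1<p))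
                    (trans (sym (haSum-of-F rule x k)) (sym (sumFin-*ha n p S c k)))
    pHa⇒hom : pHaCone n p S x → HomCone n p S T x
    pHa⇒hom (m , 1≤m , c , 0≤c , mx≡) s s∈S = +*-cancel-nonpos m 1≤m (begin
      + m * F n p T s x
        ≡⟨ F-scale n p T s (+ m) x ⟨
      F n p T s (λ k → + m * x k)
        ≡⟨ F-cong n p T s (λ k → trans (mx≡ k) (sumFin-*ha n p S c k)) ⟩
      F n p T s (haSum n p S c)
        ≡⟨ F-haSum c (λ k → cong (_* c k) (rule k)) s ⟩
      (+ 1 - + (p ℕ.^ n)) * (δ T (prev n s) * c s)
        ≤⟨ [1-p^n]*v≤0 n 1<p 0≤δc ⟩
      + 0 ∎)
      where
      open ℤ.≤-Reasoning
      0≤δc : + 0 ≤ δ T (prev n s) * c s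
      0≤δc rewrite δ-∉ (prev∉T s s∈S) | ℤ.*-identityˡ (c s) = 0≤c s s∈S

module _ (n : ℕ) {{_ : NonZero n}} (p : ℕ) (S T : Subset n) where

  δ*ha : ∀ i k → δ T k * ha n p S i k ≡ δeq i k * - (δ T i * δ S i) + δeq (prev n i) k * - (+ p * δ T (prev n i))
  δ*ha i k = begin
    δ T k * (- (δ S i * δeq i k) + - (+ p * δeq (prev n i) k))
      ≡⟨ distrib (δ T k) (δ S i) (δeq i k) (+ p) (δeq (prev n i) k) ⟩
    - (δ S i * (δ T k * δeq i k)) + - (+ p * (δ T k * δeq (prev n i) k))
      ≡⟨ cong₂ (λ u v → - (δ S i * u) + - (+ p * v)) (δeq-swap (δ T) i k) (δeq-swap (δ T) (prev n i) k) ⟨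
    - (δ S i * (δ T i * δeq i k)) + - (+ p * (δ T (prev n i) * δeq (prev n i) k))
      ≡⟨ regroup (δ T i) (δ S i) (δeq i k) (+ p) (δ T (prev n i)) (δeq (prev n i) k) ⟩
    δeq i k * - (δ T i * δ S i) + δeq (prev n i) k * - (+ p * δ T (prev n i)) ∎
    where
    open ≡-Reasoning
    distrib : ∀ t s e q e′ → t * (- (s * e) + - (q * e′)) ≡ - (s * (t * e)) + - (q * (t * e′))
    distrib = solve-∀
    regroup : ∀ t s e q t′ e′ → - (s * (t * e)) + - (q * (t′ * e′)) ≡ e * - (t * s) + e′ * - (q * t′)
    regroup = solve-∀

module _ (n : ℕ) {{_ : NonZero n}} {p : ℕ} (1<p : 1 ℕ.< p) (S T : Subset n) where
  open import Data.Integer using (_≤_; _<_)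

  F-ha-pos : ∀ i → + 0 < - (δ T i * δ S i) → prev n i ∈ T → ∀ r → + 0 < F n p T r (ha n p S i)
  F-ha-pos i 0<a i-1∈T = F-two-point-pos n 1<p T (ha n p S i) i (prev n i) (δ*ha n p S T i) 0<a 0≤b
    where
    0≤b : + 0 ≤ - (+ p * δ T (prev n i))
    0≤b rewrite δ-∈ i-1∈T | ℤ.*-comm (+ p) (- + 1) | ℤ.-1*i≡-i (+ p) | ℤ.neg-involutive (+ p) = +≤+ z≤n

  F-ha-neg : ∀ i → - (δ T i * δ S i) < + 0 → prev n i ∉ T → ∀ r → F n p T r (ha n p S i) < + 0
  F-ha-neg i a<0 i-1∉T = F-two-point-neg n 1<p T (ha n p S i) i (prev n i) (δ*ha n p S T i) a<0 b≤0
    where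
    b≤0 : - (+ p * δ T (prev n i)) ≤ + 0
    b≤0 rewrite δ-∉ i-1∉T | ℤ.*-identityʳ (+ p) = ℤ.neg-mono-≤ (+≤+ z≤n)

  F-ha-lower-bound : ∀ i r → - ((+ 1 + + p) * sumℕ n (λ j → + (p ℕ.^ j))) ≤ F n p T r (ha n p S i)
  F-ha-lower-bound i = F-lower-bound n p T (ha n p S i) (+ 1 + + p) λ k →
    subst₂ _≤_ (sym (ℤ.neg-distrib-+ (+ 1) (+ p))) (sym (δ*ha n p S T i k))
      (ℤ.+-mono-≤ (δeq-*-lower i k (-≤+) (-1≤a (lookup T i) (lookup S i)))
                  (δeq-*-lower (prev n i) k (ℤ.neg-mono-≤ (+≤+ z≤n)) (-p≤b (lookup T (prev n i)))))
    where
    -1≤a : ∀ t s → - + 1 ≤ - (δᵇ t * δᵇ s)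
    -1≤a true  true  = ℤ.≤-refl
    -1≤a true  false = -≤+
    -1≤a false true  = -≤+
    -1≤a false false = ℤ.≤-refl
    -p≤b : ∀ t → - + p ≤ - (+ p * δᵇ t)
    -p≤b true  rewrite ℤ.*-comm (+ p) (- + 1) | ℤ.-1*i≡-i (+ p) | ℤ.neg-involutive (+ p) =
      ℤ.≤-trans (ℤ.neg-mono-≤ (+≤+ z≤n)) (+≤+ z≤n)
    -p≤b false rewrite ℤ.*-identityʳ (+ p) = ℤ.≤-refl

  module _ (agree : ∀ x → pHaCone n p S x ⇔ HomCone n p S T x) where

    private
      pHa⇒hom : ∀ {x} → pHaCone n p S x → HomCone n p S T x
      pHa⇒hom {x} = Equivalence.to (agree x)

      hom⇒pHa : ∀ {x} → HomCone n p S T x → pHaCone n p S x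
      hom⇒pHa {x} = Equivalence.from (agree x)

      ha∈pHaCone : ∀ i → pHaCone n p S (ha n p S i)
      ha∈pHaCone i = pHaCone-intro n p S (δeq i) (λ s _ → 0≤δeq i s) (ha n p S i) (ha≡haSum-δeq n p S i)

      -ha∈pHaCone : ∀ i → i ∉ S → pHaCone n p S (λ k → - + 1 * ha n p S i k)
      -ha∈pHaCone i i∉S = pHaCone-intro n p S (λ j → - + 1 * δeq i j) 0≤c _
        (λ k → trans (cong (- + 1 *_) (ha≡haSum-δeq n p S i k)) (sym (haSum-scale n p S (- + 1) (δeq i) k)))
        where
        0≤c : ∀ s → s ∈ S → + 0 ≤ - + 1 * δeq i s
        0≤c s s∈S rewrite δeq-≢ {i = i} {s} (λ i≡s → i∉S (subst (_∈ S) (sym i≡s) s∈S)) = ℤ.≤-refl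

      haSum-coefficient-contradiction : ∀ {t} c → t ∈ S → c t ≡ - + 1 → ¬ HomCone n p S T (haSum n p S c)
      haSum-coefficient-contradiction c t∈S c[t]≡-1 hom = ℤ.<⇒≱ -<+
        (subst (+ 0 ≤_) c[t]≡-1 (pHaCone-coefficients-nonneg n 1<p S (hom⇒pHa hom) c (λ _ → refl) _ t∈S))

    cones-agree⇒alternating : ∀ {r} → r ∈ S → ∀ i → i ∉ S → (prev n i ∈ T × i ∉ T) ⊎ (prev n i ∉ T × i ∈ T)
    cones-agree⇒alternating {r} r∈S i i∉S with prev n i ∈? T | i ∈? T
    ... | yes i-1∈T | no  i∉T = inj₁ (i-1∈T , i∉T)
    ... | no  i-1∉T | yes i∈T = inj₂ (i-1∉T , i∈T)
    ... | yes i-1∈T | yes i∈T = ⊥-elim (ℤ.<⇒≱ (F-ha-pos i 0<a i-1∈T r) (pHa⇒hom (ha∈pHaCone i) r r∈S))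
      where
      0<a : + 0 < - (δ T i * δ S i)
      0<a rewrite δ-∈ i∈T | δ-∉ i∉S = +<+ (s≤s z≤n)
    ... | no  i-1∉T | no  i∉T = ⊥-elim (ℤ.<⇒≱ (F-ha-neg i a<0 i-1∉T r) 0≤F)
      where
      a<0 : - (δ T i * δ S i) < + 0
      a<0 rewrite δ-∉ i∉T | δ-∉ i∉S = -<+
      0≤F : + 0 ≤ F n p T r (ha n p S i)
      0≤F = ℤ.neg-cancel-≤ (subst (_≤ + 0) (trans (F-scale n p T r (- + 1) (ha n p S i)) (ℤ.-1*i≡-i _))
                                   (pHa⇒hom (-ha∈pHaCone i i∉S) r r∈S))

    cones-agree⇒prev-S-∉ : ∀ s → s ∈ S → prev n s ∉ T
    cones-agree⇒prev-S-∉ s s∈S s-1∈T with s ∈? T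
    ... | no s∉T = ℤ.<⇒≱ (F-ha-pos s 0<a s-1∈T s) (pHa⇒hom (ha∈pHaCone s) s s∈S)
      where
      0<a : + 0 < - (δ T s * δ S s)
      0<a rewrite δ-∉ s∉T | δ-∈ s∈S = +<+ (s≤s z≤n)
    ... | yes s∈T = haSum-coefficient-contradiction c s∈S (cong -_ (δeq-refl s)) hom
      where
      -- The sign rule holds at s, the only support point of c, so -haₛ = haSum c is in the homogeneous cone.
      c : Fin n → ℤ
      c j = - δeq s j
      rule-on-c : ∀ k → δ T k * δ S k * c k ≡ - δ T (prev n k) * c k
      rule-on-c k = trans (sym (ℤ.neg-distribʳ-* (δ T k * δ S k) (δeq s k)))
                          (trans (cong -_ (*δeq-cong (λ j → δ T j * δ S j) (λ j → - δ T (prev n j)) rule-at-s k))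
                                 (ℤ.neg-distribʳ-* (- δ T (prev n k)) (δeq s k)))
        where
        rule-at-s : δ T s * δ S s ≡ - δ T (prev n s)
        rule-at-s rewrite δ-∈ s∈T | δ-∈ s∈S | δ-∈ s-1∈T = refl
      0≤δ*c : ∀ r → + 0 ≤ δ T (prev n r) * c r
      0≤δ*c r = subst (+ 0 ≤_) δ*c≡ (0≤δeq s r)
        where
        δ*c≡ : δeq s r ≡ δ T (prev n r) * c r
        δ*c≡ = begin
          δeq s r
            ≡⟨ flip (δeq s r) ⟩
          - (- + 1 * δeq s r)
            ≡⟨ cong -_ (*δeq-cong (λ _ → - + 1) (λ j → δ T (prev n j)) (sym (δ-∈ s-1∈T)) r) ⟩
          - (δ T (prev n r) * δeq s r)
            ≡⟨ ℤ.neg-distribʳ-* (δ T (prev n r)) (δeq s r) ⟩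
          δ T (prev n r) * c r ∎
          where
          open ≡-Reasoning
          flip : ∀ e → e ≡ - (- + 1 * e)
          flip = solve-∀
      hom : HomCone n p S T (haSum n p S c)
      hom r _ = subst (_≤ + 0) (sym (F-haSum n 1<p S T c rule-on-c r)) ([1-p^n]*v≤0 n 1<p (0≤δ*c r))

    cones-agree⇒S-∉ : ∀ {s t} → s ∈ S → t ∈ S → t ≢ s → s ∉ T
    cones-agree⇒S-∉ {s} {t} s∈S t∈S t≢s s∈T = haSum-coefficient-contradiction c t∈S c[t]≡-1 hom
      where
      -- F_T(haₛ) ≤ -1 everywhere while -bound ≤ F_T(haₜ), so N haₛ - haₜ passes every test of the
      -- homogeneous cone although its t-coefficient is -1.
      bound = (+ 1 + + p) * sumℕ n (λ j → + (p ℕ.^ j))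
      N : ℕ
      N = ℤ.∣ bound ∣
      +N≡bound : + N ≡ bound
      +N≡bound = ℤ.0≤i⇒+∣i∣≡i (+*-nonneg (suc p) (sumℕ-nonneg n (λ j → +≤+ z≤n)))
      c : Fin n → ℤ
      c j = + N * δeq s j + - + 1 * δeq t j
      c[t]≡-1 : c t ≡ - + 1
      c[t]≡-1 = trans (cong₂ (λ e e′ → + N * e + - + 1 * e′) (δeq-≢ (λ s≡t → t≢s (sym s≡t))) (δeq-refl t))
                      (eval (+ N))
        where
        eval : ∀ a → a * + 0 + - + 1 * + 1 ≡ - + 1
        eval = solve-∀
      haSum-c≡ : ∀ k → haSum n p S c k ≡ + N * ha n p S s k + - + 1 * ha n p S t k
      haSum-c≡ k = trans (haSum-linear n p S (+ N) (- + 1) (δeq s) (δeq t) k)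
        (sym (cong₂ (λ u v → + N * u + - + 1 * v) (ha≡haSum-δeq n p S s k) (ha≡haSum-δeq n p S t k)))
      F[ha-s]≤-1 : ∀ r → F n p T r (ha n p S s) ≤ - + 1
      F[ha-s]≤-1 r = ℤ.i<j⇒i≤pred[j] (F-ha-neg s a<0 (cones-agree⇒prev-S-∉ s s∈S) r)
        where
        a<0 : - (δ T s * δ S s) < + 0
        a<0 rewrite δ-∈ s∈T | δ-∈ s∈S = -<+
      -F[ha-t]≤bound : ∀ r → - + 1 * F n p T r (ha n p S t) ≤ bound
      -F[ha-t]≤bound r = subst₂ _≤_ (sym (ℤ.-1*i≡-i _)) (ℤ.neg-involutive bound)
                                  (ℤ.neg-mono-≤ (F-ha-lower-bound t r))
      hom : HomCone n p S T (haSum n p S c)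
      hom r _ = begin
        F n p T r (haSum n p S c)
          ≡⟨ F-cong n p T r haSum-c≡ ⟩
        F n p T r (λ k → + N * ha n p S s k + - + 1 * ha n p S t k)
          ≡⟨ F-linear n p T r (+ N) (- + 1) (ha n p S s) (ha n p S t) ⟩
        + N * F n p T r (ha n p S s) + - + 1 * F n p T r (ha n p S t)
          ≤⟨ ℤ.+-mono-≤ (ℤ.*-monoˡ-≤-nonNeg (+ N) (F[ha-s]≤-1 r)) (-F[ha-t]≤bound r) ⟩
        + N * - + 1 + bound
          ≡⟨ cong (λ a → a * - + 1 + bound) +N≡bound ⟩
        bound * - + 1 + bound
          ≡⟨ cancel bound ⟩
        + 0 ∎
        where
        open ℤ.≤-Reasoning
        cancel : ∀ a → a * - + 1 + a ≡ + 0
        cancel = solve-∀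

-- Arcs of Γ_n(∅, S)

iterate : ∀ {A : Set} → (A → A) → ℕ → A → A
iterate σ zero    x = x
iterate σ (suc a) x = iterate σ a (σ x)

module _ {m} (S : Subset m) where

  -- Returns the fuel when S is not met in time; `Reaches σ` rules that out for fuel n.
  stepsToS : (Fin m → Fin m) → ℕ → Fin m → ℕ
  stepsToS σ zero    x = 0
  stepsToS σ (suc f) x with x ∈? S
  ... | yes _ = 0
  ... | no  _ = suc (stepsToS σ f (σ x))

  stepsToS-stable : ∀ σ a x → iterate σ a x ∈ S → ∀ f → a ℕ.≤ f → stepsToS σ f x ≡ stepsToS σ a x
  stepsToS-stable σ zero    x x∈S zero    _ = refl
  stepsToS-stable σ zero    x x∈S (suc f) _ with x ∈? S
  ... | yes _   = refl
  ... | no  x∉S = ⊥-elim (x∉S x∈S)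
  stepsToS-stable σ (suc a) x hit (suc f) (s≤s a≤f) with x ∈? S
  ... | yes _ = refl
  ... | no  _ = cong suc (stepsToS-stable σ a (σ x) hit f a≤f)

  iterate-stepsToS∈S : ∀ σ a x → iterate σ a x ∈ S → iterate σ (stepsToS σ a x) x ∈ S
  iterate-stepsToS∈S σ zero    x hit = hit
  iterate-stepsToS∈S σ (suc a) x hit with x ∈? S
  ... | yes x∈S = x∈S
  ... | no  _   = iterate-stepsToS∈S σ a (σ x) hit

  stepsToS-∉ : ∀ σ f {x} → x ∉ S → stepsToS σ (suc f) x ≡ suc (stepsToS σ f (σ x))
  stepsToS-∉ σ f {x} x∉S with x ∈? S
  ... | yes x∈S = ⊥-elim (x∉S x∈S)
  ... | no  _   = refl

module _ (n : ℕ) {{_ : NonZero n}} (S : Subset n) where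

  Reaches : (Fin n → Fin n) → Set
  Reaches σ = ∀ x → Σ ℕ λ a → a ℕ.< n × iterate σ a x ∈ S

  iterate-prev-shift : ∀ a s → iterate (prev n) a (shift n s a) ≡ s
  iterate-prev-shift zero    s = shift-zero n s
  iterate-prev-shift (suc a) s = trans (cong (iterate (prev n) a) (prev-shift n s a)) (iterate-prev-shift a s)

  iterate-next : ∀ a x → iterate (next n) a x ≡ shift n x a
  iterate-next zero    x = sym (shift-zero n x)
  iterate-next (suc a) x = trans (iterate-next a (next n x)) (shift-shift n x 1 a)

  prev-reaches : ∀ {s} → s ∈ S → Reaches (prev n)
  prev-reaches {s} s∈S x with shift-surjective n s x
  ... | a , a<n , refl = a , a<n , subst (_∈ S) (sym (iterate-prev-shift a s)) s∈S

  next-reaches : ∀ {s} → s ∈ S → Reaches (next n)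
  next-reaches {s} s∈S x with shift-surjective n x s
  ... | a , a<n , x+a≡s = a , a<n , subst (_∈ S) (sym (trans (iterate-next a x) x+a≡s)) s∈S

  distance : (Fin n → Fin n) → Fin n → ℕ
  distance σ = stepsToS S σ n

  arcStart : Fin n → Fin n
  arcStart x = iterate (prev n) (distance (prev n) x) x

  module _ {σ : Fin n → Fin n} (reaches : Reaches σ) where

    iterate-distance∈S : ∀ x → iterate σ (distance σ x) x ∈ S
    iterate-distance∈S x with reaches x
    ... | a , a<n , hit = subst (λ d → iterate σ d x ∈ S) (sym (stepsToS-stable S σ a x hit n (ℕ.<⇒≤ a<n)))
                                (iterate-stepsToS∈S S σ a x hit)

    distance-∈ : ∀ {x} → x ∈ S → distance σ x ≡ 0
    distance-∈ {x} x∈S = stepsToS-stable S σ 0 x x∈S n z≤n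

    distance-∉ : ∀ {x} → x ∉ S → distance σ x ≡ suc (distance σ (σ x))
    distance-∉ {x} x∉S with reaches (σ x)
    ... | a , a<n , hit = begin
      stepsToS S σ n x
        ≡⟨ cong (λ f → stepsToS S σ f x) (suc[n∸1]≡n n) ⟨
      stepsToS S σ (suc (n ∸ 1)) x
        ≡⟨ stepsToS-∉ S σ (n ∸ 1) x∉S ⟩
      suc (stepsToS S σ (n ∸ 1) (σ x))
        ≡⟨ cong suc (stepsToS-stable S σ a (σ x) hit (n ∸ 1) (ℕ.∸-monoˡ-≤ 1 a<n)) ⟩
      suc (stepsToS S σ a (σ x))
        ≡⟨ cong suc (stepsToS-stable S σ a (σ x) hit n (ℕ.<⇒≤ a<n)) ⟨
      suc (stepsToS S σ n (σ x)) ∎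
      where open ≡-Reasoning


module _ (n : ℕ) {{_ : NonZero n}} (p : ℕ) (S : Subset n) {s₀ : Fin n} (s₀∈S : s₀ ∈ S) where

  arcStart∈S : ∀ x → arcStart n S x ∈ S
  arcStart∈S = iterate-distance∈S n S (prev-reaches n S s₀∈S)

  arcStart-∈ : ∀ {x} → x ∈ S → arcStart n S x ≡ x
  arcStart-∈ {x} x∈S = cong (λ d → iterate (prev n) d x) (distance-∈ n S (prev-reaches n S s₀∈S) x∈S)

  arcStart-prev : ∀ {x} → x ∉ S → arcStart n S x ≡ arcStart n S (prev n x)
  arcStart-prev {x} x∉S = cong (λ d → iterate (prev n) d x) (distance-∉ n S (prev-reaches n S s₀∈S) x∉S)

  Edge-arcStart : ∀ {i j} → Edge n p S i j → arcStart n S i ≡ arcStart n S j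
  Edge-arcStart (inj₁ (refl , i+1∉S)) = sym (trans (arcStart-prev i+1∉S) (cong (arcStart n S) (prev-next n _)))
  Edge-arcStart (inj₂ (refl , j+1∉S)) = trans (arcStart-prev j+1∉S) (cong (arcStart n S) (prev-next n _))

  Connected⇒≡arcStart : ∀ {i j} → Connected n p S i j → arcStart n S i ≡ arcStart n S j
  Connected⇒≡arcStart ε           = refl
  Connected⇒≡arcStart (e ◅ steps) = trans (Edge-arcStart e) (Connected⇒≡arcStart steps)

  Connected-walk : ∀ f x → Connected n p S x (iterate (prev n) (stepsToS S (prev n) f x) x)
  Connected-walk zero    x = ε
  Connected-walk (suc f) x with x ∈? S
  ... | yes _   = ε
  ... | no  x∉S = inj₂ (sym (next-prev n x) , subst (_∉ S) (sym (next-prev n x)) x∉S) ◅ Connected-walk f (prev n x)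

  ≡arcStart⇒Connected : ∀ {i j} → arcStart n S i ≡ arcStart n S j → Connected n p S i j
  ≡arcStart⇒Connected {i} {j} same = Connected-walk n i ◅◅ subst (λ a → Connected n p S a j) (sym same)
                                                                (reverse Sum.swap (Connected-walk n j))

-- Parity of an arc

Alternating : (n : ℕ) {{_ : NonZero n}} → Subset n → Subset n → Set
Alternating n S T = ∀ i → i ∉ S → (prev n i ∈ T × i ∉ T) ⊎ (prev n i ∉ T × i ∈ T)

module _ (n : ℕ) {{_ : NonZero n}} (p : ℕ) (S T : Subset n)
         (alternating : Alternating n S T) (prev-S-∉ : ∀ s → s ∈ S → prev n s ∉ T)
         {s : Fin n} (s∈S : s ∈ S) (C : Subset n) (C≡component : ∀ j → j ∈ C ⇔ Connected n p S s j) where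
  open import Data.Integer using (_≤_)

  private
    I f : Fin n → ℤ
    I i = indicator (lookup C i)
    f i = indicator (lookup T i)

    S∩C⊆⁅s⁆ : ∀ {j} → j ∈ S → j ∈ C → j ≡ s
    S∩C⊆⁅s⁆ {j} j∈S j∈C = trans (sym (arcStart-∈ n p S s∈S j∈S))
      (trans (sym (Connected⇒≡arcStart n p S s∈S (Equivalence.to (C≡component j) j∈C))) (arcStart-∈ n p S s∈S s∈S))

    I-prev : ∀ {j} → j ∉ S → I (prev n j) ≡ I j
    I-prev {j} j∉S = by-cases (j ∈? C)
      where
      j-1→j : Edge n p S (prev n j) j
      j-1→j = inj₁ (sym (next-prev n j) , subst (_∉ S) (sym (next-prev n j)) j∉S)
      by-cases : Dec (j ∈ C) → I (prev n j) ≡ I j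
      by-cases (yes j∈C) = trans (indicator-∈ (Equivalence.from (C≡component (prev n j))
                                 (Equivalence.to (C≡component j) j∈C ◅◅ (Sum.swap j-1→j ◅ ε))))
                                 (sym (indicator-∈ j∈C))
      by-cases (no  j∉C) = trans (indicator-∉ λ j-1∈C → j∉C (Equivalence.from (C≡component j)
                                 (Equivalence.to (C≡component (prev n j)) j-1∈C ◅◅ (j-1→j ◅ ε))))
                                 (sym (indicator-∉ j∉C))

    f-prev : ∀ {j} → j ∉ S → f (prev n j) ≡ + 1 - f j
    f-prev {j} j∉S with alternating j j∉S
    ... | inj₁ (j-1∈T , j∉T) = trans (indicator-∈ j-1∈T) (cong (λ v → + 1 - v) (sym (indicator-∉ j∉T)))
    ... | inj₂ (j-1∉T , j∈T) = trans (indicator-∉ j-1∉T) (cong (λ v → + 1 - v) (sym (indicator-∈ j∈T)))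

    I≡ : ∀ i → I i ≡ I i * f i + I (prev n i) * f (prev n i) + δeq s i * (+ 1 - f s)
    I≡ i with i ∈? S | i Fin.≟ s
    ... | yes _   | yes refl
      rewrite indicator-∈ (Equivalence.from (C≡component s) ε) | indicator-∉ (prev-S-∉ s s∈S) | δeq-refl s
      = at-s (f s) (I (prev n s))
      where
      at-s : ∀ t j → + 1 ≡ + 1 * t + j * + 0 + + 1 * (+ 1 - t)
      at-s = solve-∀
    ... | yes i∈S | no i≢s
      rewrite indicator-∉ (λ i∈C → i≢s (S∩C⊆⁅s⁆ i∈S i∈C)) | indicator-∉ (prev-S-∉ i i∈S)
            | δeq-≢ (λ s≡i → i≢s (sym s≡i))
      = elsewhere-in-S (f i) (I (prev n i)) (f s)
      where
      elsewhere-in-S : ∀ t j u → + 0 ≡ + 0 * t + j * + 0 + + 0 * (+ 1 - u)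
      elsewhere-in-S = solve-∀
    ... | no i∉S  | _
      rewrite I-prev i∉S | f-prev i∉S | δeq-≢ (λ s≡i → i∉S (subst (_∈ S) s≡i s∈S))
      = outside-S (I i) (f i) (f s)
      where
      outside-S : ∀ j t u → j ≡ j * t + j * (+ 1 - t) + + 0 * (+ 1 - u)
      outside-S = solve-∀

  component-card : Σ ℤ λ A → + 0 ≤ A × + ∣ C ∣ ≡ A + A + (+ 1 - indicator (lookup T s))
  component-card = A , sumFin-nonneg (λ i → 0≤indicator*indicator (lookup C i) (lookup T i)) , (begin
    + ∣ C ∣
      ≡⟨ card≡sumFin-indicator C ⟩
    sumFin I
      ≡⟨ sumFin-cong I≡ ⟩
    sumFin (λ i → g i + g (prev n i) + δeq s i * (+ 1 - f s))
      ≡⟨ sumFin-distrib-+ (λ i → g i + g (prev n i)) (λ i → δeq s i * (+ 1 - f s)) ⟩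
    sumFin (λ i → g i + g (prev n i)) + sumFin (λ i → δeq s i * (+ 1 - f s))
      ≡⟨ cong₂ _+_ (sumFin-distrib-+ g (λ i → g (prev n i))) point-mass ⟩
    A + sumFin (λ i → g (prev n i)) + (+ 1 - f s)
      ≡⟨ cong (λ B → A + B + (+ 1 - f s)) (sumFin-permute g (prev-permutation n)) ⟨
    A + A + (+ 1 - f s) ∎)
    where
    open ≡-Reasoning
    g : Fin n → ℤ
    g i = I i * f i
    A = sumFin g
    point-mass : sumFin (λ i → δeq s i * (+ 1 - f s)) ≡ + 1 - f s
    point-mass = trans (sumFin-cong (λ i → trans (ℤ.*-comm (δeq s i) _) (cong ((+ 1 - f s) *_) (δeq-sym s i))))
                       (sumFin-δeq (λ _ → + 1 - f s) s)

  component-odd : s ∉ T → ∣ C ∣ % 2 ≡ 1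
  component-odd s∉T with component-card
  ... | A , 0≤A , card≡ =
    %2-of-double+ ∣ C ∣ 1 0≤A (trans card≡ (cong (λ v → A + A + (+ 1 - v)) (indicator-∉ s∉T)))

  component-even : s ∈ T → ∣ C ∣ % 2 ≡ 0
  component-even s∈T with component-card
  ... | A , 0≤A , card≡ =
    %2-of-double+ ∣ C ∣ 0 0≤A (trans card≡ (cong (λ v → A + A + (+ 1 - v)) (indicator-∈ s∈T)))

tabulate-∈ : ∀ {m} (f : Fin m → Bool) {i} → i ∈ tabulate f → f i ≡ true
tabulate-∈ f {i} i∈ = trans (sym (Vec.lookup∘tabulate f i)) (Vec.[]=⇒lookup i∈)

∈-tabulate : ∀ {m} (f : Fin m → Bool) {i} → f i ≡ true → i ∈ tabulate f
∈-tabulate f {i} fi≡true = Vec.lookup⇒[]= i (tabulate f) (trans (Vec.lookup∘tabulate f i) fi≡true)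

∉-tabulate : ∀ {m} (f : Fin m → Bool) {i} → f i ≡ false → i ∉ tabulate f
∉-tabulate f fi≡false i∈ = not-¬ refl (trans (sym (tabulate-∈ f i∈)) fi≡false)

does≡true⇒ : ∀ {A : Set} (a? : Dec A) → does a? ≡ true → A
does≡true⇒ (yes a) _ = a

odd : ℕ → Bool
odd zero    = false
odd (suc k) = not (odd k)

module _ (n : ℕ) {{_ : NonZero n}} (p : ℕ) (S : Subset n) {s₀ : Fin n} (s₀∈S : s₀ ∈ S) where

  Φ-witness : Subset n
  Φ-witness = tabulate (λ i → odd (distance n S (next n) (next n i)))

  Φ-witness-isΦ : IsΦ n p S Φ-witness
  Φ-witness-isΦ = prev-S-∉ , alternates
    where
    reaches = next-reaches n S s₀∈S
    prev-S-∉ : ∀ s → s ∈ S → prev n s ∉ Φ-witness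
    prev-S-∉ s s∈S = ∉-tabulate _ (cong odd (trans (cong (distance n S (next n)) (next-prev n s))
                                                    (distance-∈ n S reaches s∈S)))
    alternates : ∀ i → next n i ∉ S →
                 (i ∈ Φ-witness × next n i ∉ Φ-witness) ⊎ (i ∉ Φ-witness × next n i ∈ Φ-witness)
    alternates i i+1∉S with odd (distance n S (next n) (next n (next n i))) in parity
    ... | true  = inj₂ (∉-tabulate _ odd-i≡false , ∈-tabulate _ parity)
      where odd-i≡false = trans (cong odd (distance-∉ n S reaches i+1∉S)) (cong not parity)
    ... | false = inj₁ (∈-tabulate _ odd-i≡true , ∉-tabulate _ parity)
      where odd-i≡true = trans (cong odd (distance-∉ n S reaches i+1∉S)) (cong not parity)

  component : Fin n → Subset n
  component i = tabulate (λ j → does (arcStart n S j Fin.≟ arcStart n S i))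

  component-Connected : ∀ i j → j ∈ component i ⇔ Connected n p S i j
  component-Connected i j = mk⇔
    (λ j∈ → ≡arcStart⇒Connected n p S s₀∈S (sym (does≡true⇒ (_ Fin.≟ _) (tabulate-∈ _ j∈))))
    (λ i~j → ∈-tabulate _ (dec-true (_ Fin.≟ _) (sym (Connected⇒≡arcStart n p S s₀∈S i~j))))

  component-Connected-arcStart : ∀ i j → j ∈ component i ⇔ Connected n p S (arcStart n S i) j
  component-Connected-arcStart i j = mk⇔
    (λ j∈ → ≡arcStart⇒Connected n p S s₀∈S (trans (arcStart-∈ n p S s₀∈S (arcStart∈S n p S s₀∈S i))
                                                   (sym (does≡true⇒ (_ Fin.≟ _) (tabulate-∈ _ j∈)))))
    (λ s~j → ∈-tabulate _ (dec-true (_ Fin.≟ _) (trans (sym (Connected⇒≡arcStart n p S s₀∈S s~j))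
                                                        (arcStart-∈ n p S s₀∈S (arcStart∈S n p S s₀∈S i)))))

IsΦ⇒Alternating : ∀ n {{_ : NonZero n}} p {S T} → IsΦ n p S T → Alternating n S T
IsΦ⇒Alternating n p {S} {T} (_ , alternates) j j∉S =
  subst (λ k → (prev n j ∈ T × k ∉ T) ⊎ (prev n j ∉ T × k ∈ T)) (next-prev n j)
        (alternates (prev n j) (subst (_∉ S) (sym (next-prev n j)) j∉S))

record Adapted (n : ℕ) {{_ : NonZero n}} (S T : Subset n) : Set where
  field
    alternating : Alternating n S T
    prev-S-∉    : ∀ s → s ∈ S → prev n s ∉ T
    S-∉         : ∀ s → s ∈ S → s ∉ T

module _ (n : ℕ) {{_ : NonZero n}} (p : ℕ) {S T : Subset n} where

  adapted⇒AllComponentsOdd : ∀ {s₀} → s₀ ∈ S → Adapted n S T → AllComponentsOdd n p S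
  adapted⇒AllComponentsOdd s₀∈S adapted i = component n p S s₀∈S i , component-Connected n p S s₀∈S i ,
    component-odd n p S T alternating prev-S-∉ (arcStart∈S n p S s₀∈S i) (component n p S s₀∈S i)
                  (component-Connected-arcStart n p S s₀∈S i) (S-∉ _ (arcStart∈S n p S s₀∈S i))
    where open Adapted adapted

  AllComponentsOdd⇒adapted : AllComponentsOdd n p S → IsΦ n p S T → Adapted n S T
  AllComponentsOdd⇒adapted all-odd isΦ = record
    { alternating = IsΦ⇒Alternating n p isΦ
    ; prev-S-∉    = proj₁ isΦ
    ; S-∉         = S-∉
    }
    where
    S-∉ : ∀ s → s ∈ S → s ∉ T
    S-∉ s s∈S s∈T with all-odd s
    ... | C , C≡component , ∣C∣-odd = 0≢1 (trans (sym ∣C∣-even) ∣C∣-odd)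
      where
      ∣C∣-even = component-even n p S T (IsΦ⇒Alternating n p isΦ) (proj₁ isΦ) s∈S C C≡component s∈T
      0≢1 : 0 ≢ 1
      0≢1 ()

open import Data.Nat using (_≤_)

module _ {n : ℕ} {S : Subset n} (2≤∣S∣ : 2 ≤ ∣ S ∣) where

  other-∈ : ∀ s → Σ (Fin n) λ t → t ∈ S × t ≢ s
  other-∈ s with Fin.any? (λ t → t ∈? S ×-dec ¬? (t Fin.≟ s))
  ... | yes t = t
  ... | no ∄t = ⊥-elim (ℕ.<⇒≱ 2≤∣S∣ (subst (∣ S ∣ ≤_) (∣⁅x⁆∣≡1 s) (p⊆q⇒∣p∣≤∣q∣ S⊆⁅s⁆)))
    where
    S⊆⁅s⁆ : S ⊆ ⁅ s ⁆
    S⊆⁅s⁆ {t} t∈S with t Fin.≟ s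
    ... | yes refl = x∈⁅x⁆ s
    ... | no  t≢s  = ⊥-elim (∄t (t , t∈S , t≢s))

  some-∈ : {{_ : NonZero n}} → Σ (Fin n) (_∈ S)
  some-∈ with other-∈ (fromℕ< (ℕ.>-nonZero⁻¹ n))
  ... | t , t∈S , _ = t , t∈S

module _ (n : ℕ) {{_ : NonZero n}} {p : ℕ} (1<p : 1 ℕ.< p) {S T : Subset n} where

  adapted⇒SignRule : Adapted n S T → SignRule n S T
  adapted⇒SignRule adapted k with k ∈? S
  ... | yes k∈S rewrite δ-∈ k∈S | δ-∉ (Adapted.S-∉ adapted k k∈S) | δ-∉ (Adapted.prev-S-∉ adapted k k∈S) = refl
  ... | no  k∉S with Adapted.alternating adapted k k∉S
  ...   | inj₁ (k-1∈T , k∉T) rewrite δ-∉ k∉S | δ-∉ k∉T | δ-∈ k-1∈T = refl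
  ...   | inj₂ (k-1∉T , k∈T) rewrite δ-∉ k∉S | δ-∈ k∈T | δ-∉ k-1∉T = refl

  adapted⇒cones-agree : Adapted n S T → ∀ x → HomCone n p S T x ⇔ pHaCone n p S x
  adapted⇒cones-agree adapted =
    signRule⇒cones-agree n 1<p S T (adapted⇒SignRule adapted) (Adapted.prev-S-∉ adapted)

  cones-agree⇒adapted : 2 ≤ ∣ S ∣ → (∀ x → pHaCone n p S x ⇔ HomCone n p S T x) → Adapted n S T
  cones-agree⇒adapted 2≤∣S∣ agree = record
    { alternating = cones-agree⇒alternating n 1<p S T agree (proj₂ (some-∈ 2≤∣S∣))
    ; prev-S-∉    = cones-agree⇒prev-S-∉ n 1<p S T agree
    ; S-∉         = S-∉
    }
    where
    S-∉ : ∀ s → s ∈ S → s ∉ T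
    S-∉ s s∈S with other-∈ 2≤∣S∣ s
    ... | t , t∈S , t≢s = cones-agree⇒S-∉ n 1<p S T agree s∈S t∈S t≢s

theorem5p13p2 : (n : ℕ) → {{_ : NonZero n}} → (p : ℕ) → Prime p → (S : Subset n) → 2 ≤ ∣ S ∣ →
    ((∀ T → IsΦ n p S T → ∀ (x : Fin n → ℤ) → (HomCone n p S T x ⇔ pHaCone n p S x))
    ⇔ (Σ (Subset n) λ T → ∀ (x : Fin n → ℤ) → (pHaCone n p S x ⇔ HomCone n p S T x)))
    × ((∀ T → IsΦ n p S T → ∀ (x : Fin n → ℤ) → (HomCone n p S T x ⇔ pHaCone n p S x))
    ⇔ AllComponentsOdd n p S)
theorem5p13p2 n p p-prime S 2≤∣S∣ = mk⇔ i⇒ii (iii⇒i ∘ ii⇒iii) , mk⇔ (ii⇒iii ∘ i⇒ii) iii⇒i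
  where
  1<p = ℕ.nonTrivial⇒n>1 p {{prime⇒nonTrivial p-prime}}
  s₀∈S = proj₂ (some-∈ 2≤∣S∣)
  ConesAgreeForΦ Homogeneous : Set
  ConesAgreeForΦ = ∀ T → IsΦ n p S T → ∀ x → HomCone n p S T x ⇔ pHaCone n p S x
  Homogeneous = Σ (Subset n) λ T → ∀ x → pHaCone n p S x ⇔ HomCone n p S T x
  i⇒ii : ConesAgreeForΦ → Homogeneous
  i⇒ii agree = Φ-witness n p S s₀∈S , λ x → ⇔-sym (agree _ (Φ-witness-isΦ n p S s₀∈S) x)
  ii⇒iii : Homogeneous → AllComponentsOdd n p S
  ii⇒iii (T , agree) = adapted⇒AllComponentsOdd n p s₀∈S (cones-agree⇒adapted n 1<p {T = T} 2≤∣S∣ agree)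
  iii⇒i : AllComponentsOdd n p S → ConesAgreeForΦ
  iii⇒i all-odd T isΦ = adapted⇒cones-agree n 1<p (AllComponentsOdd⇒adapted n p all-odd isΦ)
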